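{- Let $L',L'':\mathbb{Z}^2\to\mathbb{Z}^2$ be defined by $L'(x,y)=(-x+2y+1,\,y)$ and $L''(x,y)=(x,\,2x-y+1)$. For $(a,b)\in\mathbb{Z}^2$ let $\mathscr{P}_L(a,b)$ be the set of all points obtained from $(a,b)$ by applying finitely many (possibly zero) operators from $\{L',L''\}$ in any order. Then the sets $\mathscr{P}_L(a,b)$ form a partition of $\mathbb{Z}^2$, and moreover: (1) each set $\mathscr{P}_L(a,b)$ contains a point $(m,m)$ with the property that $m\le\min\{x,y\}$ for every $(x,y)\in\mathscr{P}_L(a,b)$; (2) every point of $\mathscr{P}_L(0,0)$ other than the origin is of the form $(T_k,T_{k+1})$ or $(T_{k+1},T_k)$ for some integer $k\ge0$, where $T_k=k(k+1)/2$ is the $k$-th triangular number; (3) all points of $\mathscr{P}_L(0,0)$ lie on the parabola $x+y=(x-y)^2$; (4) every set $\mathscr{P}_L(a,b)$ is a translate of $\mathscr{P}_L(0,0)$ by a vector of the form $(h,h)$, $h\in\mathbb{Z}$; (5) the lattice point $(a,b)$ belongs to the set $\mathscr{P}_L(m,m)$ (the parabola with vertex $(m,m)$), where $m=\frac12\big(a+b-(a-b)^2\big)$. -}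

module Defs where

open import Data.Nat using (ℕ; suc; _*_)
open import Data.Nat.DivMod using (_/_)
open import Data.Integer using (ℤ; +_; _+_; _-_; -_; 1ℤ)
open import Data.Product using (_×_; _,_)

Point : Set
Point = ℤ × ℤ

L′ : Point → Point
L′ (x , y) = (- x + (+ 2) Data.Integer.* y + 1ℤ , y)

L″ : Point → Point
L″ (x , y) = (x , (+ 2) Data.Integer.* x - y + 1ℤ)

data 𝒫 (p : Point) : Point → Set where
  here  : 𝒫 p p
  stepL′ : ∀ {q} → 𝒫 p q → 𝒫 p (L′ q)
  stepL″ : ∀ {q} → 𝒫 p q → 𝒫 p (L″ q)

T : ℕ → ℤ
T k = + ((k * suc k) / 2)

{-# OPTIONS --safe #-}
-- L′ and L″ are involutions preserving I (x , y) = x + y − (x − y)², so 𝒫 is an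
-- equivalence relation whose classes lie in level sets of I. They send x − y to
-- 1 − (x − y) and −1 − (x − y) respectively, so alternating them walks every point
-- to the diagonal, where I (m , m) = 2m; hence 𝒫 p q holds iff I p ≡ I q, and the
-- classes are the parabolas x + y − (x − y)² = 2m. A point is determined by I and
-- x − y, which identifies the class of the origin as the pairs of consecutive
-- triangular numbers, and the other classes as its translates along the diagonal.
module Submission where

open import Defs
open import Data.Nat using (zero; suc; z≤n) renaming (_+_ to _+ℕ_; _*_ to _*ℕ_)
open import Data.Nat.Divisibility using (divides)
open import Data.Nat.DivMod using (_/_; +-distrib-/-∣ʳ; m*n/n≡m)
open import Data.Nat.Tactic.RingSolver renaming (solve-∀ to ℕ-solve-∀)
open import Data.Integer using (ℤ; +_; -[1+_]; 0ℤ; 1ℤ; -_; _+_; _-_; _*_; _≤_; +≤+; _≟_)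
open import Data.Integer.Properties
  using (*-cancelˡ-≡; i-j≡0⇒i≡j; i≡j⇒i-j≡0; 0≤i-j⇒j≤i; ≤-refl)
open import Data.Integer.Tactic.RingSolver using (solve-∀)
open import Data.Product using (_×_; _,_; ∃-syntax; proj₁; map; map₂; swap)
open import Data.Sum using (_⊎_; inj₁; inj₂)
open import Data.Empty using (⊥)
open import Relation.Binary.PropositionalEquality
  using (_≡_; refl; sym; trans; cong; cong₂; subst; module ≡-Reasoning)
open import Relation.Nullary using (yes; no)
open ≡-Reasoning

private
  variable
    p q r : Point
    x y m : ℤ

diff : Point → ℤ
diff (x , y) = x - y

I : Point → ℤ
I (x , y) = x + y - (x - y) * (x - y)

-- The ring solver does not unfold I, diff, L′ or L″, so identities about them
-- are handed to it in expanded form.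
I-L′ : ∀ p → I (L′ p) ≡ I p
I-L′ (x , y) = identity x y
  where
  identity : ∀ x y → let x′ = - x + (+ 2) * y + 1ℤ in
             x′ + y - (x′ - y) * (x′ - y) ≡ x + y - (x - y) * (x - y)
  identity = solve-∀

I-L″ : ∀ p → I (L″ p) ≡ I p
I-L″ (x , y) = identity x y
  where
  identity : ∀ x y → let y′ = (+ 2) * x - y + 1ℤ in
             x + y′ - (x - y′) * (x - y′) ≡ x + y - (x - y) * (x - y)
  identity = solve-∀

L′-involutive : ∀ p → L′ (L′ p) ≡ p
L′-involutive (x , y) = cong (_, y) (identity x y)
  where
  identity : ∀ x y → - (- x + (+ 2) * y + 1ℤ) + (+ 2) * y + 1ℤ ≡ x
  identity = solve-∀

L″-involutive : ∀ p → L″ (L″ p) ≡ p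
L″-involutive (x , y) = cong (x ,_) (identity x y)
  where
  identity : ∀ x y → (+ 2) * x - ((+ 2) * x - y + 1ℤ) + 1ℤ ≡ y
  identity = solve-∀

diff-L′ : ∀ p → diff (L′ p) ≡ 1ℤ - diff p
diff-L′ (x , y) = identity x y
  where
  identity : ∀ x y → (- x + (+ 2) * y + 1ℤ) - y ≡ 1ℤ - (x - y)
  identity = solve-∀

diff-L″ : ∀ p → diff (L″ p) ≡ - 1ℤ - diff p
diff-L″ (x , y) = identity x y
  where
  identity : ∀ x y → x - ((+ 2) * x - y + 1ℤ) ≡ - 1ℤ - (x - y)
  identity = solve-∀

I-swap : ∀ p → I (swap p) ≡ I p
I-swap (x , y) = identity x y
  where
  identity : ∀ x y → y + x - (y - x) * (y - x) ≡ x + y - (x - y) * (x - y)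
  identity = solve-∀

diff-swap : ∀ p → diff (swap p) ≡ - diff p
diff-swap (x , y) = identity x y
  where
  identity : ∀ x y → y - x ≡ - (x - y)
  identity = solve-∀

I-diagonal : ∀ m → I (m , m) ≡ (+ 2) * m
I-diagonal = identity
  where
  identity : ∀ m → m + m - (m - m) * (m - m) ≡ (+ 2) * m
  identity = solve-∀

I-translate : ∀ h x y → I (x - h , y - h) ≡ I (x , y) - (+ 2) * h
I-translate = identity
  where
  identity : ∀ h x y → let x′ = x - h ; y′ = y - h in
             x′ + y′ - (x′ - y′) * (x′ - y′) ≡ x + y - (x - y) * (x - y) - (+ 2) * h
  identity = solve-∀

I-diff-injective : ∀ p q → I p ≡ I q → diff p ≡ diff q → p ≡ q
I-diff-injective (x , y) (x′ , y′) I≡ diff≡ = cong₂ _,_ x≡x′ (begin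
  y                   ≡⟨ recover-y x y ⟩
  x - diff (x , y)    ≡⟨ cong₂ _-_ x≡x′ diff≡ ⟩
  x′ - diff (x′ , y′) ≡⟨ recover-y x′ y′ ⟨
  y′                  ∎)
  where
  recover-y : ∀ x y → y ≡ x - (x - y)
  recover-y = solve-∀

  recover-2x : ∀ x y → (+ 2) * x ≡ (x + y - (x - y) * (x - y)) + (x - y) * (x - y) + (x - y)
  recover-2x = solve-∀

  x≡x′ : x ≡ x′
  x≡x′ = *-cancelˡ-≡ (+ 2) x x′ (begin
    (+ 2) * x
      ≡⟨ recover-2x x y ⟩
    I (x , y) + diff (x , y) * diff (x , y) + diff (x , y)
      ≡⟨ cong₂ (λ i d → i + d * d + d) I≡ diff≡ ⟩
    I (x′ , y′) + diff (x′ , y′) * diff (x′ , y′) + diff (x′ , y′)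
      ≡⟨ recover-2x x′ y′ ⟨
    (+ 2) * x′
      ∎)

𝒫-trans : 𝒫 p q → 𝒫 q r → 𝒫 p r
𝒫-trans p↝q here         = p↝q
𝒫-trans p↝q (stepL′ q↝r) = stepL′ (𝒫-trans p↝q q↝r)
𝒫-trans p↝q (stepL″ q↝r) = stepL″ (𝒫-trans p↝q q↝r)

step-reversible : ∀ {f : Point → Point} → (∀ q → f (f q) ≡ q) →
                  (∀ {p q} → 𝒫 p q → 𝒫 p (f q)) → ∀ q → 𝒫 (f q) q
step-reversible {f} involutive step q = subst (𝒫 (f q)) (involutive q) (step here)

𝒫-sym : 𝒫 p q → 𝒫 q p
𝒫-sym here             = here
𝒫-sym (stepL′ {q} p↝q) = 𝒫-trans (step-reversible L′-involutive stepL′ q) (𝒫-sym p↝q)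
𝒫-sym (stepL″ {q} p↝q) = 𝒫-trans (step-reversible L″-involutive stepL″ q) (𝒫-sym p↝q)

𝒫⇒I≡ : 𝒫 p q → I p ≡ I q
𝒫⇒I≡ here             = refl
𝒫⇒I≡ (stepL′ {q} p↝q) = trans (𝒫⇒I≡ p↝q) (sym (I-L′ q))
𝒫⇒I≡ (stepL″ {q} p↝q) = trans (𝒫⇒I≡ p↝q) (sym (I-L″ q))

diagonal-reachable⁺ : ∀ n p → diff p ≡ + n → ∃[ m ] 𝒫 p (m , m)
diagonal-reachable⁻ : ∀ n p → diff p ≡ - (+ n) → ∃[ m ] 𝒫 p (m , m)

diagonal-reachable⁺ zero (x , y) x-y≡0 =
  x , subst (λ z → 𝒫 (x , z) (x , x)) (i-j≡0⇒i≡j x y x-y≡0) here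
diagonal-reachable⁺ (suc n) p diff≡ =
  map₂ (𝒫-trans (stepL′ here)) (diagonal-reachable⁻ n (L′ p) (begin
    diff (L′ p)       ≡⟨ diff-L′ p ⟩
    1ℤ - diff p       ≡⟨ cong (λ d → 1ℤ - d) diff≡ ⟩
    1ℤ - (1ℤ + + n)   ≡⟨ identity (+ n) ⟩
    - (+ n)           ∎))
  where
  identity : ∀ i → 1ℤ - (1ℤ + i) ≡ - i
  identity = solve-∀

diagonal-reachable⁻ zero p diff≡ = diagonal-reachable⁺ zero p diff≡
diagonal-reachable⁻ (suc n) p diff≡ =
  map₂ (𝒫-trans (stepL″ here)) (diagonal-reachable⁺ n (L″ p) (begin
    diff (L″ p)           ≡⟨ diff-L″ p ⟩
    - 1ℤ - diff p         ≡⟨ cong (λ d → - 1ℤ - d) diff≡ ⟩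
    - 1ℤ - - (1ℤ + + n)   ≡⟨ identity (+ n) ⟩
    + n                   ∎))
  where
  identity : ∀ i → - 1ℤ - - (1ℤ + i) ≡ i
  identity = solve-∀

diagonal-reachable : ∀ p → ∃[ m ] 𝒫 p (m , m)
diagonal-reachable p with diff p in diff≡
... | + n      = diagonal-reachable⁺ n p diff≡
... | -[1+ n ] = diagonal-reachable⁻ (suc n) p diff≡

I-vertex : 𝒫 p (m , m) → I p ≡ (+ 2) * m
I-vertex {m = m} p↝m = trans (𝒫⇒I≡ p↝m) (I-diagonal m)

I≡⇒𝒫 : I p ≡ I q → 𝒫 p q
I≡⇒𝒫 {p} {q} I≡ with diagonal-reachable p | diagonal-reachable q
... | m , p↝m | m′ , q↝m′
  with refl ← *-cancelˡ-≡ (+ 2) m m′ (trans (sym (I-vertex p↝m)) (trans I≡ (I-vertex q↝m′)))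
  = 𝒫-trans p↝m (𝒫-sym q↝m′)

𝒫-equal-or-disjoint : ∀ p q →
  (∀ z → (𝒫 p z → 𝒫 q z) × (𝒫 q z → 𝒫 p z)) ⊎ (∀ z → 𝒫 p z → 𝒫 q z → ⊥)
𝒫-equal-or-disjoint p q with I p ≟ I q
... | yes I≡ = inj₁ λ z → (λ p↝z → I≡⇒𝒫 (trans (sym I≡) (𝒫⇒I≡ p↝z)))
                        , (λ q↝z → I≡⇒𝒫 (trans I≡ (𝒫⇒I≡ q↝z)))
... | no I≢  = inj₂ λ z p↝z q↝z → I≢ (trans (𝒫⇒I≡ p↝z) (sym (𝒫⇒I≡ q↝z)))

𝒫-translate : 𝒫 p (m , m) → ∀ x y →
  (𝒫 p (x , y) → 𝒫 (0ℤ , 0ℤ) (x - m , y - m)) × (𝒫 (0ℤ , 0ℤ) (x - m , y - m) → 𝒫 p (x , y))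
𝒫-translate {p} {m} p↝m x y = to-origin , from-origin
  where
  to-origin : 𝒫 p (x , y) → 𝒫 (0ℤ , 0ℤ) (x - m , y - m)
  to-origin p↝xy = I≡⇒𝒫 (sym (trans (I-translate m x y)
    (i≡j⇒i-j≡0 (trans (sym (𝒫⇒I≡ p↝xy)) (I-vertex p↝m)))))

  from-origin : 𝒫 (0ℤ , 0ℤ) (x - m , y - m) → 𝒫 p (x , y)
  from-origin o↝xy = I≡⇒𝒫 (trans (I-vertex p↝m) (sym (i-j≡0⇒i≡j _ _
    (trans (sym (I-translate m x y)) (sym (𝒫⇒I≡ o↝xy))))))

T-suc : ∀ k → T (suc k) ≡ T k + + suc k
T-suc k = cong +_ (begin
  suc k *ℕ suc (suc k) / 2               ≡⟨ cong (_/ 2) (expand k) ⟩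
  (k *ℕ suc k +ℕ suc k *ℕ 2) / 2         ≡⟨ +-distrib-/-∣ʳ (k *ℕ suc k) (divides (suc k) refl) ⟩
  k *ℕ suc k / 2 +ℕ suc k *ℕ 2 / 2       ≡⟨ cong (k *ℕ suc k / 2 +ℕ_) (m*n/n≡m (suc k) 2) ⟩
  k *ℕ suc k / 2 +ℕ suc k                ∎)
  where
  expand : ∀ k → (1 +ℕ k) *ℕ (2 +ℕ k) ≡ k *ℕ (1 +ℕ k) +ℕ (1 +ℕ k) *ℕ 2
  expand = ℕ-solve-∀

T-double : ∀ k → T k + T k ≡ + k * + suc k
T-double zero    = refl
T-double (suc k) = begin
  T (suc k) + T (suc k)      ≡⟨ cong₂ _+_ (T-suc k) (T-suc k) ⟩
  (T k + s) + (T k + s)      ≡⟨ regroup (T k) s ⟩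
  (T k + T k) + (s + s)      ≡⟨ cong (_+ (s + s)) (T-double k) ⟩
  + k * s + (s + s)          ≡⟨ factor (+ k) ⟩
  s * (1ℤ + s)               ∎
  where
  s : ℤ
  s = + suc k

  regroup : ∀ t s → (t + s) + (t + s) ≡ (t + t) + (s + s)
  regroup = solve-∀

  factor : ∀ K → K * (1ℤ + K) + ((1ℤ + K) + (1ℤ + K)) ≡ (1ℤ + K) * (1ℤ + (1ℤ + K))
  factor = solve-∀

I-triangular : ∀ k → I (T (suc k) , T k) ≡ 0ℤ
I-triangular k = begin
  I (T (suc k) , T k)          ≡⟨ cong (λ u → I (u , T k)) (T-suc k) ⟩
  I (T k + s , T k)            ≡⟨ expand (T k) s ⟩
  (T k + T k) + s - s * s      ≡⟨ cong (λ u → u + s - s * s) (T-double k) ⟩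
  + k * s + s - s * s          ≡⟨ cancel (+ k) ⟩
  0ℤ                           ∎
  where
  s : ℤ
  s = + suc k

  expand : ∀ t s → (t + s) + t - ((t + s) - t) * ((t + s) - t) ≡ (t + t) + s - s * s
  expand = solve-∀

  cancel : ∀ K → K * (1ℤ + K) + (1ℤ + K) - (1ℤ + K) * (1ℤ + K) ≡ 0ℤ
  cancel = solve-∀

diff-triangular : ∀ k → diff (T (suc k) , T k) ≡ + suc k
diff-triangular k = trans (cong (_- T k) (T-suc k)) (identity (T k) (+ suc k))
  where
  identity : ∀ t s → (t + s) - t ≡ s
  identity = solve-∀

level-zero-points : I (x , y) ≡ 0ℤ →
  (x , y) ≡ (0ℤ , 0ℤ) ⊎ ∃[ k ] ((x , y) ≡ (T k , T (suc k)) ⊎ (x , y) ≡ (T (suc k) , T k))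
level-zero-points {x} {y} I≡0 = by-diff (diff (x , y)) refl
  where
  by-diff : ∀ d → diff (x , y) ≡ d →
    (x , y) ≡ (0ℤ , 0ℤ) ⊎ ∃[ k ] ((x , y) ≡ (T k , T (suc k)) ⊎ (x , y) ≡ (T (suc k) , T k))
  by-diff (+ zero)  diff≡ = inj₁ (I-diff-injective _ _ I≡0 diff≡)
  by-diff (+ suc k) diff≡ = inj₂ (k , inj₂ (I-diff-injective _ _
    (trans I≡0 (sym (I-triangular k)))
    (trans diff≡ (sym (diff-triangular k)))))
  by-diff -[1+ k ]  diff≡ = inj₂ (k , inj₁ (cong swap (I-diff-injective (y , x) _
    (trans (I-swap (x , y)) (trans I≡0 (sym (I-triangular k))))
    (trans (diff-swap (x , y)) (trans (cong -_ diff≡) (sym (diff-triangular k)))))))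

𝒫₀-nonnegative : 𝒫 (0ℤ , 0ℤ) (x , y) → 0ℤ ≤ x × 0ℤ ≤ y
𝒫₀-nonnegative {x} {y} o↝xy with level-zero-points {x} {y} (sym (𝒫⇒I≡ o↝xy))
... | inj₁ refl            = ≤-refl , ≤-refl
... | inj₂ (k , inj₁ refl) = +≤+ z≤n , +≤+ z≤n
... | inj₂ (k , inj₂ refl) = +≤+ z≤n , +≤+ z≤n

vertex-minimal : 𝒫 p (m , m) → 𝒫 p (x , y) → m ≤ x × m ≤ y
vertex-minimal p↝m p↝xy =
  map 0≤i-j⇒j≤i 0≤i-j⇒j≤i (𝒫₀-nonnegative (proj₁ (𝒫-translate p↝m _ _) p↝xy))

theorem1p2 :
    -- the sets 𝒫 p form a partition of ℤ²: they cover ℤ², and any two are equal or disjoint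
    ((z : Point) → ∃[ p ] 𝒫 p z)
    × ((p q : Point) → ((z : Point) → (𝒫 p z → 𝒫 q z) × (𝒫 q z → 𝒫 p z))
                       ⊎ ((z : Point) → 𝒫 p z → 𝒫 q z → ⊥))
    -- (1) each set contains a point (m,m) with m ≤ min{x,y} on the set
    × ((a b : ℤ) → ∃[ m ] (𝒫 (a , b) (m , m)
                          × ((x y : ℤ) → 𝒫 (a , b) (x , y) → (m ≤ x) × (m ≤ y))))
    -- (2) points of 𝒫(0,0) other than the origin are (T k, T (k+1)) or (T (k+1), T k)
    × ((x y : ℤ) → 𝒫 (0ℤ , 0ℤ) (x , y) →
         ((x , y) ≡ (0ℤ , 0ℤ))
         ⊎ (∃[ k ] ((x , y) ≡ (T k , T (suc k)) ⊎ (x , y) ≡ (T (suc k) , T k))))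
    -- (3) all points of 𝒫(0,0) lie on the parabola x + y = (x - y)²
    × ((x y : ℤ) → 𝒫 (0ℤ , 0ℤ) (x , y) → x + y ≡ (x - y) * (x - y))
    -- (4) each set is the translate of 𝒫(0,0) by some (h,h)
    × ((a b : ℤ) → ∃[ h ] ((x y : ℤ) →
         (𝒫 (a , b) (x , y) → 𝒫 (0ℤ , 0ℤ) (x - h , y - h))
         × (𝒫 (0ℤ , 0ℤ) (x - h , y - h) → 𝒫 (a , b) (x , y))))
    -- (5) (a,b) ∈ 𝒫(m,m) where m = (a + b - (a - b)²)/2
    × ((a b m : ℤ) → (+ 2) * m ≡ a + b - (a - b) * (a - b) → 𝒫 (m , m) (a , b))
theorem1p2 =
    (λ z → z , here)
  , 𝒫-equal-or-disjoint
  , (λ a b → let m , a↝m = diagonal-reachable (a , b) in m , a↝m , λ _ _ → vertex-minimal a↝m)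
  , (λ x y o↝xy → level-zero-points (sym (𝒫⇒I≡ o↝xy)))
  , (λ x y o↝xy → i-j≡0⇒i≡j _ _ (sym (𝒫⇒I≡ o↝xy)))
  , (λ a b → let m , a↝m = diagonal-reachable (a , b) in m , 𝒫-translate a↝m)
  , (λ a b m 2m≡I → I≡⇒𝒫 (trans (I-diagonal m) 2m≡I))
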